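{- Let $X=\{(2^m,2^k): m,k\geq 0 \text{ integers}\}\subseteq\mathbb{N}^2$ and $E=\{(a,b)\in\mathbb{N}^2: b\leq\log_2 a\}\cup\{(a,b)\in\mathbb{N}^2: a\leq \log_2 b\}$. For every $D\in\mathbb{N}$ there exist $x_0,y_0\in\mathbb{N}$ such that the square $S_D=\{(s_1,s_2)\in\mathbb{N}^2: x_0\leq s_1\leq x_0+D,\ y_0\leq s_2\leq y_0+D\}$ satisfies $S_D\subseteq E$ and $FS(X)\cap S_D=\emptyset$.
   Context: $\mathbb{N}=\{1,2,\dots\}$. For $X\subseteq\mathbb{N}^2$, $FS(X)$ is the set of all finite sums of distinct elements of $X$. -}

module Defs where

open import Data.Nat using (ℕ; _+_; _^_; _≤_)
open import Data.Nat.Logarithm using (⌊log₂_⌋)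
open import Data.List using (List; []; map)
open import Data.Nat.ListAction using (sum)
open import Data.List.Relation.Unary.Unique.Propositional using (Unique)
open import Data.Product using (_×_; Σ; proj₁; proj₂)
open import Data.Sum using (_⊎_)
open import Relation.Binary.PropositionalEquality using (_≡_; _≢_)

-- X = {(2^m, 2^k) : m,k ≥ 0}; an element of X is indexed by its exponent pair (m , k),
-- and (m , k) ↦ (2^m , 2^k) is injective, so distinct elements of X = distinct exponent pairs.

InFS : ℕ → ℕ → Set
InFS a b = Σ (List (ℕ × ℕ)) λ L →
  Unique L × L ≢ [] ×
  a ≡ sum (map (λ p → 2 ^ proj₁ p) L) ×
  b ≡ sum (map (λ p → 2 ^ proj₂ p) L)

-- E = {(a,b) : b ≤ log₂ a} ∪ {(a,b) : a ≤ log₂ b}.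
-- For natural b and a ≥ 1:  b ≤ log₂ a  ⇔  b ≤ ⌊log₂ a⌋.
InE : ℕ → ℕ → Set
InE a b = (b ≤ ⌊log₂ a ⌋) ⊎ (a ≤ ⌊log₂ b ⌋)

-- A sum of n powers of two lying below 2^L is at most 2^L − 2^(L−n): splitting off the
-- summands equal to 1 and halving the rest reduces L by one, and the split-off ones are
-- absorbed because z + 2^c ≤ 2^(z+c).  With A = 2^(D+1), the first coordinates of the square
-- lie strictly between A² − A and A², while for (s₁ , s₂) ∈ FS(X) the first coordinate is a sum
-- of at most s₂ ≤ D + 1 powers of two (each summand adds at least 1 to s₂), hence s₁ ≤ A² − A.
-- Membership in E only uses s₁ ≥ A.
module Submission where

open import Defs
open import Data.Nat using (ℕ; zero; suc; _+_; _*_; _^_; _≤_; _<_; z≤n; s≤s; pred; >-nonZero)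
open import Data.Nat.Properties
open import Algebra.Properties.CommutativeSemigroup +-commutativeSemigroup
  using (x∙yz≈y∙xz; xy∙z≈y∙xz)
open import Data.Nat.Logarithm using (⌊log₂_⌋; ⌊log₂⌋-mono-≤; ⌊log₂[2^n]⌋≡n)
open import Data.Nat.ListAction using (sum)
open import Data.List using (List; []; _∷_; map; length)
open import Data.List.Properties using (length-map; map-∘)
open import Data.Product using (Σ; _×_; _,_; proj₁; proj₂)
open import Data.Empty using (⊥)
open import Data.Sum using (inj₁)
open import Relation.Binary.PropositionalEquality
open import Relation.Nullary using (¬_; contradiction)

sumPow2 : List ℕ → ℕ
sumPow2 ms = sum (map (2 ^_) ms)

length≤sumPow2 : ∀ ms → length ms ≤ sumPow2 ms
length≤sumPow2 []       = z≤n
length≤sumPow2 (m ∷ ms) = +-mono-≤ (m^n>0 2 m) (length≤sumPow2 ms)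

InFS⇒sumPow2-of-length≤ : ∀ {a b} → InFS a b →
  Σ (List ℕ) λ ms → length ms ≤ b × a ≡ sumPow2 ms
InFS⇒sumPow2-of-length≤ {b = b} (L , _ , _ , a≡ , b≡) =
  map proj₁ L , length-bound , trans a≡ (cong sum (map-∘ L))
  where
  length-bound : length (map proj₁ L) ≤ b
  length-bound = begin
    length (map proj₁ L) ≡⟨ trans (length-map proj₁ L) (sym (length-map proj₂ L)) ⟩
    length (map proj₂ L) ≤⟨ length≤sumPow2 (map proj₂ L) ⟩
    sumPow2 (map proj₂ L) ≡⟨ cong sum (map-∘ L) ⟨
    sum (map (λ p → 2 ^ proj₂ p) L) ≡⟨ b≡ ⟨
    b ∎
    where open ≤-Reasoning

ones : List ℕ → ℕ
ones []           = 0
ones (zero  ∷ ms) = suc (ones ms)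
ones (suc _ ∷ ms) = ones ms

halved : List ℕ → List ℕ
halved []           = []
halved (zero  ∷ ms) = halved ms
halved (suc m ∷ ms) = m ∷ halved ms

length-ones-halved : ∀ ms → length ms ≡ ones ms + length (halved ms)
length-ones-halved []           = refl
length-ones-halved (zero  ∷ ms) = cong suc (length-ones-halved ms)
length-ones-halved (suc _ ∷ ms) =
  trans (cong suc (length-ones-halved ms)) (sym (+-suc (ones ms) _))

sumPow2-ones-halved : ∀ ms → sumPow2 ms ≡ ones ms + 2 * sumPow2 (halved ms)
sumPow2-ones-halved []           = refl
sumPow2-ones-halved (zero  ∷ ms) = cong suc (sumPow2-ones-halved ms)
sumPow2-ones-halved (suc m ∷ ms) =
  trans (cong (2 * 2 ^ m +_) (sumPow2-ones-halved ms))
    (trans (x∙yz≈y∙xz (2 * 2 ^ m) (ones ms) _)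
           (cong (ones ms +_) (sym (*-distribˡ-+ 2 (2 ^ m) (sumPow2 (halved ms))))))

n+2^m≤2^[n+m] : ∀ n m → n + 2 ^ m ≤ 2 ^ (n + m)
n+2^m≤2^[n+m] zero    m = ≤-refl
n+2^m≤2^[n+m] (suc n) m = begin
  suc (n + 2 ^ m)         ≤⟨ s≤s (n+2^m≤2^[n+m] n m) ⟩
  suc (2 ^ (n + m))       ≤⟨ +-monoˡ-≤ (2 ^ (n + m)) (m^n>0 2 (n + m)) ⟩
  2 ^ (n + m) + 2 ^ (n + m) ≡⟨ cong (2 ^ (n + m) +_) (+-identityʳ _) ⟨
  2 ^ suc (n + m)         ∎
  where open ≤-Reasoning

n<2^n : ∀ n → n < 2 ^ n
n<2^n n = subst₂ (λ k l → k ≤ 2 ^ l) (+-comm n 1) (+-identityʳ n) (n+2^m≤2^[n+m] n 0)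

sumPow2-gap : ∀ L ms c → length ms + c ≤ L → sumPow2 ms < 2 ^ L →
  sumPow2 ms + 2 ^ c ≤ 2 ^ L
sumPow2-gap zero ms zero _ s<1 rewrite n<1⇒n≡0 s<1 = ≤-refl
sumPow2-gap zero ms (suc c) n+c≤0 _ = contradiction (m+n≤o⇒n≤o (length ms) n+c≤0) λ ()
sumPow2-gap (suc L) ms c n+c≤L s<2^L with ones ms + c in z+c≡
... | zero rewrite m+n≡0⇒n≡0 (ones ms) z+c≡ = subst (_≤ 2 ^ suc L) (+-comm 1 _) s<2^L
... | suc c' = begin
  sumPow2 ms + 2 ^ c      ≡⟨ cong (_+ 2 ^ c) (sumPow2-ones-halved ms) ⟩
  z + 2 * t + 2 ^ c       ≡⟨ xy∙z≈y∙xz z (2 * t) _ ⟩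
  2 * t + (z + 2 ^ c)     ≤⟨ +-monoʳ-≤ (2 * t) (n+2^m≤2^[n+m] z c) ⟩
  2 * t + 2 ^ (z + c)     ≡⟨ cong (λ k → 2 * t + 2 ^ k) z+c≡ ⟩
  2 * t + 2 * 2 ^ c'      ≡⟨ *-distribˡ-+ 2 t (2 ^ c') ⟨
  2 * (t + 2 ^ c')        ≤⟨ *-monoʳ-≤ 2 (sumPow2-gap L (halved ms) c' n'+c'≤L t<2^L) ⟩
  2 * 2 ^ L               ∎
  where
  open ≤-Reasoning
  z = ones ms
  t = sumPow2 (halved ms)
  n'+c'≤L : length (halved ms) + c' ≤ L
  n'+c'≤L = ≤-pred (≤-trans (≤-reflexive split) n+c≤L)
    where
    split : suc (length (halved ms) + c') ≡ length ms + c
    split = begin-equality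
      suc (length (halved ms) + c') ≡⟨ +-suc (length (halved ms)) c' ⟨
      length (halved ms) + suc c'   ≡⟨ cong (length (halved ms) +_) z+c≡ ⟨
      length (halved ms) + (z + c)  ≡⟨ x∙yz≈y∙xz _ z c ⟩
      z + (length (halved ms) + c)  ≡⟨ +-assoc z _ c ⟨
      z + length (halved ms) + c    ≡⟨ cong (_+ c) (length-ones-halved ms) ⟨
      length ms + c                 ∎
  t<2^L : t < 2 ^ L
  t<2^L = *-cancelˡ-< 2 t (2 ^ L)
    (≤-<-trans (m≤n+m (2 * t) z) (subst (_< 2 ^ suc L) (sumPow2-ones-halved ms) s<2^L))

sumPow2∉gap : ∀ n c ms → length ms ≤ n →
  sumPow2 ms < 2 ^ (n + c) → 2 ^ (n + c) < sumPow2 ms + 2 ^ c → ⊥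
sumPow2∉gap n c ms len≤n below above =
  <⇒≱ above (sumPow2-gap (n + c) ms c (+-monoˡ-≤ c len≤n) below)

proposition3p2 : (D : ℕ) → 1 ≤ D →
    Σ ℕ λ x₀ → Σ ℕ λ y₀ → 1 ≤ x₀ × 1 ≤ y₀ ×
      ((s₁ s₂ : ℕ) → x₀ ≤ s₁ → s₁ ≤ x₀ + D → y₀ ≤ s₂ → s₂ ≤ y₀ + D →
        InE s₁ s₂ × ¬ InFS s₁ s₂)
proposition3p2 D _ = x₀ , 1 , s≤s z≤n , ≤-refl ,
  λ s₁ s₂ x₀≤s₁ s₁≤x₀+D _ s₂≤1+D → inj₁ (s₂≤⌊log₂s₁⌋ x₀≤s₁ s₂≤1+D) , ∉FS x₀≤s₁ s₁≤x₀+D s₂≤1+D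
  where
  open ≤-Reasoning
  A = 2 ^ suc D
  a = pred A
  L = suc D + suc D
  x₀ = suc (a * A)

  2^L≡a*A+A : 2 ^ L ≡ a * A + A
  2^L≡a*A+A = trans (^-distribˡ-+-* 2 (suc D) (suc D))
    (trans (cong (_* A) (sym (suc-pred A {{m^n≢0 2 (suc D)}}))) (+-comm A (a * A)))

  A≤x₀ : A ≤ x₀
  A≤x₀ = ≤-trans (m≤n*m A a {{>-nonZero (pred-mono-≤ (*-monoʳ-≤ 2 (m^n>0 2 D)))}}) (n≤1+n _)

  s₂≤⌊log₂s₁⌋ : ∀ {s₁ s₂} → x₀ ≤ s₁ → s₂ ≤ suc D → s₂ ≤ ⌊log₂ s₁ ⌋
  s₂≤⌊log₂s₁⌋ {s₁} {s₂} x₀≤s₁ s₂≤1+D = begin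
    s₂           ≤⟨ s₂≤1+D ⟩
    suc D        ≡⟨ ⌊log₂[2^n]⌋≡n (suc D) ⟨
    ⌊log₂ A ⌋    ≤⟨ ⌊log₂⌋-mono-≤ (≤-trans A≤x₀ x₀≤s₁) ⟩
    ⌊log₂ s₁ ⌋   ∎

  s<2^L : ∀ {s} → s ≤ x₀ + D → s < 2 ^ L
  s<2^L {s} s≤x₀+D = begin-strict
    s               ≤⟨ s≤x₀+D ⟩
    suc (a * A + D) ≡⟨ +-suc (a * A) D ⟨
    a * A + suc D   <⟨ +-monoʳ-< (a * A) (n<2^n (suc D)) ⟩
    a * A + A       ≡⟨ 2^L≡a*A+A ⟨
    2 ^ L           ∎

  2^L<s+A : ∀ {s} → x₀ ≤ s → 2 ^ L < s + A
  2^L<s+A {s} x₀≤s = begin-strict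
    2 ^ L           ≡⟨ 2^L≡a*A+A ⟩
    a * A + A       <⟨ +-monoˡ-≤ A x₀≤s ⟩
    s + A           ∎

  ∉FS : ∀ {s₁ s₂} → x₀ ≤ s₁ → s₁ ≤ x₀ + D → s₂ ≤ suc D → ¬ InFS s₁ s₂
  ∉FS x₀≤s₁ s₁≤x₀+D s₂≤1+D s∈FS with InFS⇒sumPow2-of-length≤ s∈FS
  ... | ms , length≤s₂ , refl =
    sumPow2∉gap (suc D) (suc D) ms (≤-trans length≤s₂ s₂≤1+D) (s<2^L s₁≤x₀+D) (2^L<s+A x₀≤s₁)
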